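{- Let $m$ and $n$ be distinct odd positive integers, let $G$ be a group of order $v=2mn+1$, and let $\Pi$ be an Archdeacon embedding of $K_v$ (arising from a Heffter array over $G$ with compatible orderings) such that every edge lies on a face whose boundary is an $m$-cycle and on a face whose boundary is an $n$-cycle. Then $\Pi$ has no orientation-reversing automorphism fixing the vertex $0$, i.e. $\mathrm{Aut}_0^-(\Pi)=\emptyset$.
   Context: A Heffter array $H(m',n';h,k)$ over a finite group $G$ (written additively) of order $2n'k+1$ is an $m'\times n'$ partially filled array with entries in $G$ such that each row has $h$ filled cells, each column has $k$ filled cells, every row and every column sums to $0$, and the multiset $\{\pm x: x$ an entry$\}$ contains each element of $G\setminus\{0\}$ exactly once. Let $\mathcal{E}(A)$ be the set of entries. Row orderings (cyclic orders of each row's entries) define a permutation $\omega_r$ of $\mathcal{E}(A)$ sending each entry to the next in its row; column orderings define $\omega_c$ similarly; they are compatible if $\omega_c\circ\omega_r$ is a single cycle of length $|\mathcal{E}(A)|$. The Archdeacon embedding is $\Pi=(K_v,\rho)$, where $K_v$ has vertex set $G$, $\rho((x,x+a))=(x,x+\rho_0(a))$ on oriented edges, and $\rho_0(a)=-\omega_r(a)$ if $a\in\mathcal{E}(A)$, $\rho_0(a)=\omega_c(-a)$ if $a\in-\mathcal{E}(A)$. Faces are the boundary walks given by the orbits of $(x,y)\mapsto(y,\rho_y(x))$ on oriented edges, where $\rho(y,z)=(y,\rho_y(z))$. An automorphism of $\Pi$ is a graph automorphism $\sigma$ of $K_v$ with either $\sigma\circ\rho=\rho\circ\sigma$ (orientation-preserving)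 or $\sigma\circ\rho=\rho^{ -1}\circ\sigma$ (orientation-reversing) on all oriented edges. $\mathrm{Aut}_0^-(\Pi)$ denotes the set of orientation-reversing automorphisms fixing $0$. -}

module Defs where

open import Data.Nat as ℕ using (ℕ; zero; suc)
open import Data.Fin using (Fin; zero; suc; toℕ; _≟_)
open import Data.Fin.Properties using (any?)
open import Data.Maybe using (Maybe; just; nothing; fromMaybe; is-just)
import Data.Maybe.Properties as MaybeP
open import Data.Product using (Σ; ∃; ∃-syntax; _×_; _,_; proj₁)
open import Data.Sum using (_⊎_)
open import Data.Bool using (Bool; true; false; if_then_else_)
open import Relation.Nullary using (Dec; yes; no; does; ¬_)
open import Relation.Binary.PropositionalEquality using (_≡_; _≢_)
open import Algebra.Structures using (IsAbelianGroup)
open import Function using (_∘_)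

-- A finite abelian group of order v, with carrier Fin v and
-- propositional equality (every group of order v is isomorphic to one of these).
record FinAbGroup (v : ℕ) : Set where
  field
    _+_ : Fin v → Fin v → Fin v
    0# : Fin v
    -_ : Fin v → Fin v
    isAbelianGroup : IsAbelianGroup _≡_ _+_ 0# -_

Σℕ : ∀ {k} → (Fin k → ℕ) → ℕ
Σℕ {zero} f = 0
Σℕ {suc k} f = f zero ℕ.+ Σℕ (f ∘ suc)

count : ∀ {k} → (Fin k → Bool) → ℕ
count f = Σℕ (λ i → if f i then 1 else 0)

ind : ∀ {p} {P : Set p} → Dec P → ℕ
ind d = if does d then 1 else 0

iterate : ∀ {A : Set} → (A → A) → ℕ → A → A
iterate f zero a = a
iterate f (suc t) a = f (iterate f t a)

module _ {v : ℕ} (𝔾 : FinAbGroup v) where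
  open FinAbGroup 𝔾

  G : Set
  G = Fin v

  ΣG : ∀ {k} → (Fin k → G) → G
  ΣG {zero} f = 0#
  ΣG {suc k} f = f zero + ΣG (f ∘ suc)

  -- multiplicity of g in the multiset {±x : x an entry} (one x and one -x per filled cell)
  contrib : Maybe G → G → ℕ
  contrib nothing g = 0
  contrib (just x) g = ind (x ≟ g) ℕ.+ ind ((- x) ≟ g)

  pmMultiplicity : ∀ {m' n'} → (Fin m' → Fin n' → Maybe G) → G → ℕ
  pmMultiplicity A g = Σℕ (λ i → Σℕ (λ j → contrib (A i j) g))

  -- A partially filled m' × n' array A (nothing = empty cell) is a Heffter array
  -- H(m',n';h,k) over G (with |G| = 2 n' k + 1).
  record IsHeffterArray {m' n' : ℕ} (h k : ℕ) (A : Fin m' → Fin n' → Maybe G) : Set where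
    field
      order     : v ≡ 2 ℕ.* n' ℕ.* k ℕ.+ 1
      rowFilled : ∀ i → count (λ j → is-just (A i j)) ≡ h
      colFilled : ∀ j → count (λ i → is-just (A i j)) ≡ k
      rowSum    : ∀ i → ΣG (λ j → fromMaybe 0# (A i j)) ≡ 0#
      colSum    : ∀ j → ΣG (λ i → fromMaybe 0# (A i j)) ≡ 0#
      pmZero    : pmMultiplicity A 0# ≡ 0
      pmNonzero : ∀ g → g ≢ 0# → pmMultiplicity A g ≡ 1

  Entry : ∀ {m' n'} → (Fin m' → Fin n' → Maybe G) → G → Set
  Entry A a = ∃[ i ] ∃[ j ] A i j ≡ just a

  entry? : ∀ {m' n'} (A : Fin m' → Fin n' → Maybe G) (a : G) → Dec (Entry A a)
  entry? A a = any? (λ i → any? (λ j → MaybeP.≡-dec _≟_ (A i j) (just a)))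

  -- ωr is the permutation of ℰ(A) induced by a choice of row orderings:
  -- it maps each row's entries to entries of the same row, cyclically
  -- (every entry of a row is reached from every other entry of that row).
  IsRowOrdering : ∀ {m' n'} → (Fin m' → Fin n' → Maybe G) → (G → G) → Set
  IsRowOrdering A ωr =
    ∀ i j a → A i j ≡ just a →
      (∃[ j' ] A i j' ≡ just (ωr a)) ×
      (∀ j' b → A i j' ≡ just b → ∃[ t ] iterate ωr t a ≡ b)

  IsColumnOrdering : ∀ {m' n'} → (Fin m' → Fin n' → Maybe G) → (G → G) → Set
  IsColumnOrdering A ωc =
    ∀ i j a → A i j ≡ just a →
      (∃[ i' ] A i' j ≡ just (ωc a)) ×
      (∀ i' b → A i' j ≡ just b → ∃[ t ] iterate ωc t a ≡ b)

  Compatible : ∀ {m' n'} → (Fin m' → Fin n' → Maybe G) → (G → G) → (G → G) → Set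
  Compatible A ωr ωc =
    ∀ a b → Entry A a → Entry A b → ∃[ t ] iterate (ωc ∘ ωr) t a ≡ b

  -- ρ₀ of the Archdeacon embedding (value on 0 is irrelevant)
  ρ₀ : ∀ {m' n'} → (Fin m' → Fin n' → Maybe G) → (G → G) → (G → G) → G → G
  ρ₀ A ωr ωc a = if does (entry? A a) then - (ωr a) else ωc (- a)

  -- local rotation at x: ρ((x , z)) = (x , rot x z), i.e. ρ((x, x+a)) = (x, x+ρ₀(a))
  rot : ∀ {m' n'} → (Fin m' → Fin n' → Maybe G) → (G → G) → (G → G) → G → G → G
  rot A ωr ωc x z = x + ρ₀ A ωr ωc (z + (- x))

  faceStep : ∀ {m' n'} → (Fin m' → Fin n' → Maybe G) → (G → G) → (G → G) → G × G → G × G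
  faceStep A ωr ωc (x , y) = (y , rot A ωr ωc y x)

  FaceIsCycle : ∀ {m' n'} → (Fin m' → Fin n' → Maybe G) → (G → G) → (G → G) → ℕ → G × G → Set
  FaceIsCycle A ωr ωc ℓ d =
    (iterate (faceStep A ωr ωc) ℓ d ≡ d) ×
    (∀ (i j : Fin ℓ) →
       proj₁ (iterate (faceStep A ωr ωc) (toℕ i) d) ≡ proj₁ (iterate (faceStep A ωr ωc) (toℕ j) d) →
       i ≡ j)

  EveryEdgeOnMNFaces : ∀ {m' n'} → (Fin m' → Fin n' → Maybe G) → (G → G) → (G → G) → ℕ → ℕ → Set
  EveryEdgeOnMNFaces A ωr ωc m n =
    ∀ x y → x ≢ y →
      (FaceIsCycle A ωr ωc m (x , y) ⊎ FaceIsCycle A ωr ωc m (y , x)) ×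
      (FaceIsCycle A ωr ωc n (x , y) ⊎ FaceIsCycle A ωr ωc n (y , x))

  -- σ ∘ ρ = ρ⁻¹ ∘ σ on all oriented edges (x , y), written as ρ ∘ σ ∘ ρ = σ
  OrientationReversing : ∀ {m' n'} → (Fin m' → Fin n' → Maybe G) → (G → G) → (G → G) → (G → G) → Set
  OrientationReversing A ωr ωc σ =
    ∀ x y → x ≢ y → rot A ωr ωc (σ x) (σ (rot A ωr ωc x y)) ≡ σ y

{-# OPTIONS --safe #-}
-- Let ρ = ρ₀ and let φ be the face-tracing map. Compatibility makes ρ a single cycle on
-- G ∖ {0}. An orientation-reversing σ fixing 0 satisfies ρ σ ρ = σ there, so σ is an
-- involution reflecting that cycle, and τ (x , y) = (σ y , σ x) satisfies φ τ φ = τ, i.e. it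
-- reverses every face. Each arc lies on a face of one length in {m , n} and its reverse on a
-- face of the other, so σ fixes only 0, and the face through (0 , ρⁱ w) alternates between the
-- two lengths as i increases. For x ≠ 0 the arc (x , σ x) is fixed by τ; as m and n are odd,
-- the reflected m-face through it has an axis point p (σ p = ρ p) with (x , σ x) diametrically
-- opposite (0 , ρ p), and likewise some axis point r has an n-face through (0 , ρ r). Parity
-- along the cycle then shows that p does not depend on x, so every nonzero x is an endpoint of
-- one fixed arc, contradicting |G| = 2mn + 1 > 3.
module Submission where

open import Defs
open import Data.Nat using (ℕ; _+_; _*_)
open import Data.Fin using (Fin)
open import Data.Maybe using (Maybe)
open import Data.Product using (Σ; ∃; _×_)
open import Relation.Nullary using (¬_)
open import Relation.Binary.PropositionalEquality using (_≡_; _≢_)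
open import Function.Definitions using (Bijective)

open import Level using (0ℓ)
open import Data.Nat using (zero; suc; _≤_; _<_; z≤n; s≤s)
import Data.Nat.Properties as ℕₚ
open import Data.Nat.Tactic.RingSolver using (solve-∀)
import Data.Fin as Fin
import Data.Fin.Properties as Finₚ
open import Data.Maybe using (just; nothing)
import Data.Maybe.Properties as Maybeₚ
open import Data.Product using (_,_; proj₁; proj₂)
import Data.Product.Properties as Productₚ
open import Data.Sum using (_⊎_; inj₁; inj₂)
import Data.Sum as Sum
open import Data.Empty using (⊥; ⊥-elim)
open import Data.Bool using (if_then_else_)
open import Relation.Nullary using (Dec; yes; no)
open import Relation.Nullary.Decidable using (dec-true; dec-false; toSum)
open import Relation.Binary.PropositionalEquality
  using (refl; sym; trans; cong; cong₂; subst; module ≡-Reasoning)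
open import Function using (_∘_)
open import Algebra.Bundles using (Group)
open import Algebra.Structures using (IsAbelianGroup)

open ≡-Reasoning

Σℕ-≢0⇒∃ : ∀ {k} (f : Fin k → ℕ) → Σℕ f ≢ 0 → ∃ λ i → f i ≢ 0
Σℕ-≢0⇒∃ {zero}  f Σ≢0 = ⊥-elim (Σ≢0 refl)
Σℕ-≢0⇒∃ {suc k} f Σ≢0 with f Fin.zero ℕₚ.≟ 0
... | no f₀≢0 = Fin.zero , f₀≢0
... | yes f₀≡0 with Σℕ-≢0⇒∃ (f ∘ Fin.suc) (Σ≢0 ∘ cong₂ _+_ f₀≡0)
...   | i , fᵢ≢0 = Fin.suc i , fᵢ≢0

term≤Σℕ : ∀ {k} (f : Fin k → ℕ) i → f i ≤ Σℕ f
term≤Σℕ f Fin.zero    = ℕₚ.m≤m+n _ _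
term≤Σℕ f (Fin.suc i) = ℕₚ.≤-trans (term≤Σℕ (f ∘ Fin.suc) i) (ℕₚ.m≤n+m _ _)

two-terms≤Σℕ : ∀ {k} (f : Fin k → ℕ) {i j} → i ≢ j → f i + f j ≤ Σℕ f
two-terms≤Σℕ f {Fin.zero}  {Fin.zero}  i≢j = ⊥-elim (i≢j refl)
two-terms≤Σℕ f {Fin.zero}  {Fin.suc j} _   = ℕₚ.+-monoʳ-≤ (f Fin.zero) (term≤Σℕ (f ∘ Fin.suc) j)
two-terms≤Σℕ f {Fin.suc i} {Fin.zero}  _   =
  ℕₚ.≤-trans (ℕₚ.≤-reflexive (ℕₚ.+-comm _ (f Fin.zero)))
             (ℕₚ.+-monoʳ-≤ (f Fin.zero) (term≤Σℕ (f ∘ Fin.suc) i))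
two-terms≤Σℕ f {Fin.suc i} {Fin.suc j} i≢j =
  ℕₚ.≤-trans (two-terms≤Σℕ (f ∘ Fin.suc) (i≢j ∘ cong Fin.suc)) (ℕₚ.m≤n+m _ _)

Σℕ² : ∀ {a b} → (Fin a → Fin b → ℕ) → ℕ
Σℕ² f = Σℕ (λ i → Σℕ (f i))

term≤Σℕ² : ∀ {a b} (f : Fin a → Fin b → ℕ) i j → f i j ≤ Σℕ² f
term≤Σℕ² f i j = ℕₚ.≤-trans (term≤Σℕ (f i) j) (term≤Σℕ (Σℕ ∘ f) i)

two-terms≤Σℕ² : ∀ {a b} (f : Fin a → Fin b → ℕ) {i j i′ j′} →
                (i , j) ≢ (i′ , j′) → f i j + f i′ j′ ≤ Σℕ² f
two-terms≤Σℕ² f {i} {j} {i′} {j′} ij≢i′j′ with i Finₚ.≟ i′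
... | yes refl = ℕₚ.≤-trans (two-terms≤Σℕ (f i) (ij≢i′j′ ∘ cong (i ,_))) (term≤Σℕ (Σℕ ∘ f) i)
... | no i≢i′  = ℕₚ.≤-trans (ℕₚ.+-mono-≤ (term≤Σℕ (f i) j) (term≤Σℕ (f i′) j′))
                            (two-terms≤Σℕ (Σℕ ∘ f) i≢i′)

ind-yes : ∀ {p} {P : Set p} (d : Dec P) → P → ind d ≡ 1
ind-yes d p = cong (if_then 1 else 0) (dec-true d p)

even⊎odd : ∀ j → ∃ λ k → j ≡ k + k ⊎ j ≡ suc (k + k)
even⊎odd zero = 0 , inj₁ refl
even⊎odd (suc j) with even⊎odd j
... | k , inj₁ refl = k , inj₂ refl
... | k , inj₂ refl = suc k , inj₁ (cong suc (sym (ℕₚ.+-suc k k)))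

odd⇒>0 : ∀ {m} a → m ≡ 2 * a + 1 → 0 < m
odd⇒>0 a refl = subst (0 <_) (ℕₚ.+-comm 1 (2 * a)) (s≤s z≤n)

odd≡half+suc-half : ∀ a → 2 * a + 1 ≡ a + suc a
odd≡half+suc-half = solve-∀

2≤m*n : ∀ {m n} → m ≢ n → 0 < m → 0 < n → 2 ≤ m * n
2≤m*n {suc zero}    {suc zero}    m≢n _ _ = ⊥-elim (m≢n refl)
2≤m*n {suc zero}    {suc (suc n)} _   _ _ = s≤s (s≤s z≤n)
2≤m*n {suc (suc m)} {suc n}       _   _ _ =
  ℕₚ.*-mono-≤ {2} {suc (suc m)} {1} {suc n} (s≤s (s≤s z≤n)) (s≤s z≤n)

3<2*m*n+1 : ∀ {m n} → m ≢ n → 0 < m → 0 < n → 3 < 2 * m * n + 1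
3<2*m*n+1 {m} {n} m≢n m>0 n>0 = ℕₚ.≤-trans 4≤2*m*n (ℕₚ.m≤m+n _ 1)
  where
  4≤2*m*n : 4 ≤ 2 * m * n
  4≤2*m*n = subst (4 ≤_) (sym (ℕₚ.*-assoc 2 m n)) (ℕₚ.*-monoʳ-≤ 2 (2≤m*n m≢n m>0 n>0))

≤3-if-covered : ∀ {v} (a b c : Fin v) → (∀ x → x ≡ a ⊎ x ≡ b ⊎ x ≡ c) → v ≤ 3
≤3-if-covered {v} a b c cover = Finₚ.injective⇒≤ {f = index} index-injective
  where
  index : Fin v → Fin 3
  index x with x Finₚ.≟ a | x Finₚ.≟ b
  ... | yes _ | _     = Fin.zero
  ... | no _  | yes _ = Fin.suc Fin.zero
  ... | no _  | no _  = Fin.suc (Fin.suc Fin.zero)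

  element : Fin 3 → Fin v
  element Fin.zero                 = a
  element (Fin.suc Fin.zero)       = b
  element (Fin.suc (Fin.suc _))    = c

  element-index : ∀ x → element (index x) ≡ x
  element-index x with x Finₚ.≟ a | x Finₚ.≟ b | cover x
  ... | yes x≡a | _       | _                = sym x≡a
  ... | no _    | yes x≡b | _                = sym x≡b
  ... | no x≢a  | no _    | inj₁ x≡a         = ⊥-elim (x≢a x≡a)
  ... | no _    | no x≢b  | inj₂ (inj₁ x≡b)  = ⊥-elim (x≢b x≡b)
  ... | no _    | no _    | inj₂ (inj₂ x≡c)  = sym x≡c

  index-injective : ∀ {x y} → index x ≡ index y → x ≡ y
  index-injective {x} {y} eq = trans (sym (element-index x)) (trans (cong element eq) (element-index y))

another-element : ∀ {v} → 1 < v → (z : Fin v) → ∃ λ x → x ≢ z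
another-element (s≤s (s≤s z≤n)) z with z Finₚ.≟ Fin.zero
... | yes refl = Fin.suc Fin.zero , λ ()
... | no z≢0   = Fin.zero , z≢0 ∘ sym

module _ {A : Set} (f : A → A) where

  iterate-suc : ∀ t a → iterate f (suc t) a ≡ iterate f t (f a)
  iterate-suc zero    a = refl
  iterate-suc (suc t) a = cong f (iterate-suc t a)

  iterate-+ : ∀ s t a → iterate f (s + t) a ≡ iterate f s (iterate f t a)
  iterate-+ zero    t a = refl
  iterate-+ (suc s) t a = cong f (iterate-+ s t a)

  iterate-comm : ∀ s t a → iterate f s (iterate f t a) ≡ iterate f t (iterate f s a)
  iterate-comm s t a = begin
    iterate f s (iterate f t a) ≡⟨ iterate-+ s t a ⟨
    iterate f (s + t) a         ≡⟨ cong (λ u → iterate f u a) (ℕₚ.+-comm s t) ⟩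
    iterate f (t + s) a         ≡⟨ iterate-+ t s a ⟩
    iterate f t (iterate f s a) ∎

  iterate-preserves : ∀ {P : A → Set} → (∀ {a} → P a → P (f a)) → ∀ t {a} → P a → P (iterate f t a)
  iterate-preserves         f-pres zero    pa = pa
  iterate-preserves {P = P} f-pres (suc t) pa = f-pres (iterate-preserves {P = P} f-pres t pa)

  iterate-returns-* : ∀ {s a} → iterate f s a ≡ a → ∀ c → iterate f (c * s) a ≡ a
  iterate-returns-* _ zero = refl
  iterate-returns-* {s} {a} returns (suc c) = begin
    iterate f (s + c * s) a         ≡⟨ iterate-+ s (c * s) a ⟩
    iterate f s (iterate f (c * s) a) ≡⟨ cong (iterate f s) (iterate-returns-* returns c) ⟩
    iterate f s a                   ≡⟨ returns ⟩
    a                               ∎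

  -- 2c = c·2(2k+1) − k·4c is a combination of the two return times.
  iterate-returns-halve : ∀ {a} k c →
    iterate f (suc (k + k) + suc (k + k)) a ≡ a →
    iterate f ((c + c) + (c + c)) a ≡ a →
    iterate f (c + c) a ≡ a
  iterate-returns-halve {a} k c odd-returns even-returns = begin
    iterate f (c + c) a
      ≡⟨ cong (iterate f (c + c)) (iterate-returns-* even-returns k) ⟨
    iterate f (c + c) (iterate f (k * ((c + c) + (c + c))) a)
      ≡⟨ iterate-+ (c + c) _ a ⟨
    iterate f ((c + c) + k * ((c + c) + (c + c))) a
      ≡⟨ cong (λ t → iterate f t a) (halving k c) ⟨
    iterate f (c * (suc (k + k) + suc (k + k))) a
      ≡⟨ iterate-returns-* odd-returns c ⟩
    a ∎
    where
    halving : ∀ k c → c * (suc (k + k) + suc (k + k)) ≡ (c + c) + k * ((c + c) + (c + c))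
    halving = solve-∀

  record MinimalPeriod (ℓ : ℕ) (a : A) : Set where
    field
      returns : iterate f ℓ a ≡ a
      minimal : ∀ i → suc i < ℓ → iterate f (suc i) a ≢ a

  open MinimalPeriod public

  minimal-period-≤ : ∀ {ℓ a} → MinimalPeriod ℓ a → ∀ i → iterate f (suc i) a ≡ a → ℓ ≤ suc i
  minimal-period-≤ {ℓ} period i returns-at-i with ℓ ℕₚ.≤? suc i
  ... | yes ℓ≤i+1 = ℓ≤i+1
  ... | no  ℓ≰i+1 = ⊥-elim (minimal period i (ℕₚ.≰⇒> ℓ≰i+1) returns-at-i)

  minimal-period-unique : ∀ {ℓ ℓ′ a} → MinimalPeriod ℓ a → MinimalPeriod ℓ′ a → 0 < ℓ → 0 < ℓ′ → ℓ ≡ ℓ′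
  minimal-period-unique {suc ℓ} {suc ℓ′} p p′ (s≤s z≤n) (s≤s z≤n) =
    ℕₚ.≤-antisym (minimal-period-≤ p ℓ′ (returns p′)) (minimal-period-≤ p′ ℓ (returns p))

  minimal-period-step : ∀ {ℓ a} → MinimalPeriod ℓ a → MinimalPeriod ℓ (f a)
  minimal-period-step {ℓ} {a} p .returns = trans (sym (iterate-suc ℓ a)) (cong f (returns p))
  minimal-period-step {suc ℓ} {a} p .minimal i i<ℓ fa-returns = minimal p i i<ℓ (begin
    iterate f (suc i) a                      ≡⟨ cong (iterate f (suc i)) (trans (sym (iterate-suc ℓ a)) (returns p)) ⟨
    iterate f (suc i) (iterate f ℓ (f a))    ≡⟨ iterate-comm (suc i) ℓ (f a) ⟩
    iterate f ℓ (iterate f (suc i) (f a))    ≡⟨ cong (iterate f ℓ) fa-returns ⟩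
    iterate f ℓ (f a)                        ≡⟨ iterate-suc ℓ a ⟨
    iterate f (suc ℓ) a                      ≡⟨ returns p ⟩
    a                                        ∎)

  minimal-period-iterate : ∀ t {ℓ a} → MinimalPeriod ℓ a → MinimalPeriod ℓ (iterate f t a)
  minimal-period-iterate zero    p = p
  minimal-period-iterate (suc t) p = minimal-period-step (minimal-period-iterate t p)

-- Instantiated twice: ρ against σ on G ∖ {0}, and faceStep against (x , y) ↦ (σ y , σ x) on arcs.
module Reversal {A : Set} (P : A → Set) (f τ : A → A)
  (f-preserves : ∀ {a} → P a → P (f a)) (τ-preserves : ∀ {a} → P a → P (τ a))
  (τ-injective : ∀ {a b} → τ a ≡ τ b → a ≡ b)
  (reverses : ∀ {a} → P a → f (τ (f a)) ≡ τ a) where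

  iterate-preserves-P : ∀ t {a} → P a → P (iterate f t a)
  iterate-preserves-P = iterate-preserves f {P} f-preserves

  iterate-reverses : ∀ t {a} → P a → iterate f t (τ (iterate f t a)) ≡ τ a
  iterate-reverses zero    _  = refl
  iterate-reverses (suc t) {a} pa = begin
    iterate f (suc t) (τ (f (iterate f t a)))  ≡⟨ iterate-suc f t _ ⟩
    iterate f t (f (τ (f (iterate f t a))))    ≡⟨ cong (iterate f t) (reverses (iterate-preserves-P t pa)) ⟩
    iterate f t (τ (iterate f t a))            ≡⟨ iterate-reverses t pa ⟩
    τ a                                        ∎

  iterate-injective : ∀ t {a b} → P a → P b → iterate f t a ≡ iterate f t b → a ≡ b
  iterate-injective t {a} {b} pa pb eq = τ-injective (begin
    τ a                              ≡⟨ iterate-reverses t pa ⟨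
    iterate f t (τ (iterate f t a))  ≡⟨ cong (iterate f t ∘ τ) eq ⟩
    iterate f t (τ (iterate f t b))  ≡⟨ iterate-reverses t pb ⟩
    τ b                              ∎)

  involutive-on-orbit : ∀ t {a} → P a → τ a ≡ iterate f t a → τ (τ a) ≡ a
  involutive-on-orbit t {a} pa τa≡ = trans (cong τ τa≡) (iterate-injective t pττa pa (begin
    iterate f t (τ (iterate f t a))  ≡⟨ iterate-reverses t pa ⟩
    τ a                              ≡⟨ τa≡ ⟩
    iterate f t a                    ∎))
    where
    pττa : P (τ (iterate f t a))
    pττa = subst P (cong τ τa≡) (τ-preserves (τ-preserves pa))

  returns-reversed : ∀ ℓ {a} → P a → iterate f ℓ a ≡ a → iterate f ℓ (τ a) ≡ τ a
  returns-reversed ℓ {a} pa returns-a = begin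
    iterate f ℓ (τ a)                ≡⟨ cong (iterate f ℓ ∘ τ) returns-a ⟨
    iterate f ℓ (τ (iterate f ℓ a))  ≡⟨ iterate-reverses ℓ pa ⟩
    τ a                              ∎

  minimal-period-reversed : (∀ a → τ (τ a) ≡ a) → ∀ {ℓ a} → P a →
                            MinimalPeriod f ℓ a → MinimalPeriod f ℓ (τ a)
  minimal-period-reversed _ {ℓ} pa p .returns = returns-reversed ℓ pa (returns p)
  minimal-period-reversed τ-involutive {a = a} pa p .minimal i i<ℓ τa-returns =
    minimal p i i<ℓ (subst (λ b → iterate f (suc i) b ≡ b) (τ-involutive a)
                           (returns-reversed (suc i) (τ-preserves pa) τa-returns))

  axis-returns : ∀ j {p} → P p → τ p ≡ f p → τ (iterate f j p) ≡ f (iterate f j p) →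
                 iterate f (j + j) p ≡ p
  axis-returns j {p} pp τp≡fp τpⱼ≡fpⱼ = iterate-injective 1 (iterate-preserves-P (j + j) pp) pp (begin
    f (iterate f (j + j) p)             ≡⟨ cong (λ t → iterate f t p) (ℕₚ.+-suc j j) ⟨
    iterate f (j + suc j) p             ≡⟨ iterate-+ f j (suc j) p ⟩
    iterate f j (f (iterate f j p))     ≡⟨ cong (iterate f j) τpⱼ≡fpⱼ ⟨
    iterate f j (τ (iterate f j p))     ≡⟨ iterate-reverses j pp ⟩
    τ p                                 ≡⟨ τp≡fp ⟩
    f p                                 ∎)

  odd-orbit-midpoint : ∀ c {a} → P a → τ a ≡ a → iterate f (c + suc c) a ≡ a →
             τ (iterate f (suc c) a) ≡ iterate f c a
  odd-orbit-midpoint c {a} pa τa≡a returns-a = begin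
    τ b                                   ≡⟨ returns-reversed (c + suc c) pb b-returns ⟨
    iterate f (c + suc c) (τ b)           ≡⟨ iterate-+ f c (suc c) (τ b) ⟩
    iterate f c (iterate f (suc c) (τ b)) ≡⟨ cong (iterate f c) (iterate-reverses (suc c) pa) ⟩
    iterate f c (τ a)                     ≡⟨ cong (iterate f c) τa≡a ⟩
    iterate f c a                         ∎
    where
    b : A
    b = iterate f (suc c) a
    pb : P b
    pb = iterate-preserves-P (suc c) pa
    b-returns : iterate f (c + suc c) b ≡ b
    b-returns = trans (iterate-comm f (c + suc c) (suc c) a) (cong (iterate f (suc c)) returns-a)

group : ∀ {v} → FinAbGroup v → Group 0ℓ 0ℓ
group 𝔾 = record { isGroup = IsAbelianGroup.isGroup (FinAbGroup.isAbelianGroup 𝔾) }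

module HeffterEntries {v} (𝔾 : FinAbGroup v) {m′ n′ h k} {A : Fin m′ → Fin n′ → Maybe (Fin v)}
  (HA : IsHeffterArray 𝔾 h k A) where

  open FinAbGroup 𝔾 using (0#) renaming (-_ to ⊖_)
  open IsHeffterArray HA
  open import Algebra.Properties.Group (group 𝔾) using (⁻¹-involutive)

  private
    E : Fin v → Set
    E = Entry 𝔾 A

    multiplicity : Fin v → ℕ
    multiplicity = pmMultiplicity 𝔾 A

  cell≤multiplicity : ∀ a i j → contrib 𝔾 (A i j) a ≤ multiplicity a
  cell≤multiplicity a = term≤Σℕ² (λ i j → contrib 𝔾 (A i j) a)

  entry-counted : ∀ {i j a} → A i j ≡ just a → 1 ≤ contrib 𝔾 (A i j) a
  entry-counted {a = a} eq rewrite eq | ind-yes (a Fin.≟ a) refl = s≤s z≤n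

  negated-entry-counted : ∀ {i j a} → A i j ≡ just (⊖ a) → 1 ≤ contrib 𝔾 (A i j) a
  negated-entry-counted {a = a} eq rewrite eq | ind-yes (⊖ (⊖ a) Fin.≟ a) (⁻¹-involutive a) =
    ℕₚ.m≤n+m 1 _

  self-inverse-entry-counted-twice : ∀ {i j a} → A i j ≡ just a → ⊖ a ≡ a → 2 ≤ contrib 𝔾 (A i j) a
  self-inverse-entry-counted-twice {a = a} eq ⊖a≡a
    rewrite eq | ind-yes (a Fin.≟ a) refl | ind-yes (⊖ a Fin.≟ a) ⊖a≡a = ℕₚ.≤-refl

  entry≢0 : ∀ {a} → E a → a ≢ 0#
  entry≢0 (i , j , eq) refl =
    ℕₚ.<-irrefl (sym pmZero) (ℕₚ.≤-trans (entry-counted eq) (cell≤multiplicity 0# i j))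

  entry⇒¬negated-entry : ∀ {a} → E a → ¬ E (⊖ a)
  entry⇒¬negated-entry {a} (i , j , eq) (i′ , j′ , eq′) =
    ℕₚ.<-irrefl (sym (pmNonzero a (entry≢0 (i , j , eq))))
                (counted-twice (Productₚ.≡-dec Finₚ._≟_ Finₚ._≟_ (i , j) (i′ , j′)))
    where
    counted-twice : Dec ((i , j) ≡ (i′ , j′)) → 2 ≤ multiplicity a
    counted-twice (yes refl) =
      ℕₚ.≤-trans (self-inverse-entry-counted-twice eq (Maybeₚ.just-injective (trans (sym eq′) eq)))
                 (cell≤multiplicity a i j)
    counted-twice (no ij≢i′j′) =
      ℕₚ.≤-trans (ℕₚ.+-mono-≤ (entry-counted eq) (negated-entry-counted eq′))
                 (two-terms≤Σℕ² (λ i j → contrib 𝔾 (A i j) a) ij≢i′j′)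

  nonzero⇒entry⊎negated-entry : ∀ {a} → a ≢ 0# → E a ⊎ E (⊖ a)
  nonzero⇒entry⊎negated-entry {a} a≢0
    with i , row≢0 ← Σℕ-≢0⇒∃ _ (λ m≡0 → ℕₚ.0≢1+n (trans (sym m≡0) (pmNonzero a a≢0)))
    with j , cell≢0 ← Σℕ-≢0⇒∃ _ row≢0
    with A i j in eq
  ... | nothing = ⊥-elim (cell≢0 refl)
  ... | just x with x Fin.≟ a | ⊖ x Fin.≟ a
  ...   | yes refl | _        = inj₁ (i , j , eq)
  ...   | no _     | yes refl = inj₂ (i , j , trans eq (cong just (sym (⁻¹-involutive x))))
  ...   | no _     | no _     = ⊥-elim (cell≢0 refl)

  nonentry⇒negated-entry : ∀ {a} → a ≢ 0# → ¬ E a → E (⊖ a)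
  nonentry⇒negated-entry a≢0 ¬ea with nonzero⇒entry⊎negated-entry a≢0
  ... | inj₁ ea  = ⊥-elim (¬ea ea)
  ... | inj₂ e-a = e-a

module Rotation {v} (𝔾 : FinAbGroup v) {m′ n′ h k} {A : Fin m′ → Fin n′ → Maybe (Fin v)}
  (HA : IsHeffterArray 𝔾 h k A) {ωr ωc : Fin v → Fin v}
  (RO : IsRowOrdering 𝔾 A ωr) (CO : IsColumnOrdering 𝔾 A ωc) (CP : Compatible 𝔾 A ωr ωc) where

  open FinAbGroup 𝔾 renaming (_+_ to _⊕_; -_ to ⊖_)
  open IsAbelianGroup isAbelianGroup using (identityˡ; identityʳ)
  open import Algebra.Properties.Group (group 𝔾)
    using (⁻¹-involutive; ε⁻¹≈ε; identityʳ-unique; x∙y⁻¹≈ε⇒x≈y)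
  open HeffterEntries 𝔾 HA

  private
    E : Fin v → Set
    E = Entry 𝔾 A

  ρ : Fin v → Fin v
  ρ = ρ₀ 𝔾 A ωr ωc

  φ : Fin v × Fin v → Fin v × Fin v
  φ = faceStep 𝔾 A ωr ωc

  IsArc : Fin v × Fin v → Set
  IsArc (x , y) = x ≢ y

  ⊖-nonzero : ∀ {a} → a ≢ 0# → ⊖ a ≢ 0#
  ⊖-nonzero {a} a≢0 ⊖a≡0 = a≢0 (trans (sym (⁻¹-involutive a)) (trans (cong ⊖_ ⊖a≡0) ε⁻¹≈ε))

  ωr-entry : ∀ {a} → E a → E (ωr a)
  ωr-entry (i , j , eq) = i , proj₁ (RO i j _ eq)

  ωc-entry : ∀ {a} → E a → E (ωc a)
  ωc-entry (i , j , eq) with i′ , eq′ ← proj₁ (CO i j _ eq) = i′ , j , eq′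

  ωr-preimage : ∀ {b} → E b → ∃ λ a → E a × ωr a ≡ b
  ωr-preimage {b} (i , j , eq)
    with j′ , eq′ ← proj₁ (RO i j b eq)
    with t , ωrᵗ⁺¹b≡b ← proj₂ (RO i j′ (ωr b) eq′) j b eq
    = iterate ωr t b , iterate-preserves ωr {E} ωr-entry t (i , j , eq) , trans (iterate-suc ωr t b) ωrᵗ⁺¹b≡b

  ρ-entry : ∀ {a} → E a → ρ a ≡ ⊖ ωr a
  ρ-entry {a} ea rewrite dec-true (entry? 𝔾 A a) ea = refl

  ρ-nonentry : ∀ {a} → ¬ E a → ρ a ≡ ωc (⊖ a)
  ρ-nonentry {a} ¬ea rewrite dec-false (entry? 𝔾 A a) ¬ea = refl

  ρ-nonzero : ∀ {a} → a ≢ 0# → ρ a ≢ 0#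
  ρ-nonzero {a} a≢0 with entry? 𝔾 A a
  ... | yes ea  = ⊖-nonzero (entry≢0 (ωr-entry ea))
  ... | no ¬ea  = entry≢0 (ωc-entry (nonentry⇒negated-entry a≢0 ¬ea))

  ρ-nonentry-entry : ∀ {a} → a ≢ 0# → ¬ E a → E (ρ a)
  ρ-nonentry-entry a≢0 ¬ea = subst E (sym (ρ-nonentry ¬ea)) (ωc-entry (nonentry⇒negated-entry a≢0 ¬ea))

  ρ²-entry : ∀ {a} → E a → ρ (ρ a) ≡ ωc (ωr a)
  ρ²-entry {a} ea = begin
    ρ (ρ a)            ≡⟨ cong ρ (ρ-entry ea) ⟩
    ρ (⊖ ωr a)         ≡⟨ ρ-nonentry (entry⇒¬negated-entry (ωr-entry ea)) ⟩
    ωc (⊖ (⊖ ωr a))    ≡⟨ cong ωc (⁻¹-involutive (ωr a)) ⟩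
    ωc (ωr a)          ∎

  ρ-iterate-even : ∀ t {a} → E a → iterate ρ (t + t) a ≡ iterate (ωc ∘ ωr) t a
  ρ-iterate-even zero    _  = refl
  ρ-iterate-even (suc t) {a} ea = begin
    iterate ρ (suc t + suc t) a          ≡⟨ cong (λ s → iterate ρ (suc s) a) (ℕₚ.+-suc t t) ⟩
    ρ (ρ (iterate ρ (t + t) a))          ≡⟨ cong (ρ ∘ ρ) (ρ-iterate-even t ea) ⟩
    ρ (ρ (iterate (ωc ∘ ωr) t a))        ≡⟨ ρ²-entry (iterate-preserves (ωc ∘ ωr) {E} (ωc-entry ∘ ωr-entry) t ea) ⟩
    ωc (ωr (iterate (ωc ∘ ωr) t a))      ∎

  -- Compatibility makes ρ² = ωc ∘ ωr a single cycle on the entries, and ρ maps the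
  -- entries onto their negatives.
  entry-reaches : ∀ {a b} → E a → b ≢ 0# → ∃ λ t → iterate ρ t a ≡ b
  entry-reaches {a} {b} ea b≢0 with nonzero⇒entry⊎negated-entry b≢0
  ... | inj₁ eb with t , a→b ← CP a b ea eb = t + t , trans (ρ-iterate-even t ea) a→b
  entry-reaches {a} {b} ea b≢0 | inj₂ e-b
    with b′ , eb′ , ωrb′≡⊖b ← ωr-preimage e-b
    with t , a→b′ ← CP a b′ ea eb′
    = suc (t + t) , (begin
      ρ (iterate ρ (t + t) a)  ≡⟨ cong ρ (trans (ρ-iterate-even t ea) a→b′) ⟩
      ρ b′                     ≡⟨ ρ-entry eb′ ⟩
      ⊖ ωr b′                  ≡⟨ cong ⊖_ ωrb′≡⊖b ⟩
      ⊖ (⊖ b)                  ≡⟨ ⁻¹-involutive b ⟩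
      b                        ∎)

  nonzero-reaches : ∀ {a b} → a ≢ 0# → b ≢ 0# → ∃ λ t → iterate ρ t a ≡ b
  nonzero-reaches {a} a≢0 b≢0 with entry? 𝔾 A a
  ... | yes ea = entry-reaches ea b≢0
  ... | no ¬ea with t , ρa→b ← entry-reaches (ρ-nonentry-entry a≢0 ¬ea) b≢0 =
    suc t , trans (iterate-suc ρ t a) ρa→b

  rot-at-0 : ∀ z → rot 𝔾 A ωr ωc 0# z ≡ ρ z
  rot-at-0 z = begin
    0# ⊕ ρ (z ⊕ (⊖ 0#))  ≡⟨ identityˡ _ ⟩
    ρ (z ⊕ (⊖ 0#))       ≡⟨ cong (λ w → ρ (z ⊕ w)) ε⁻¹≈ε ⟩
    ρ (z ⊕ 0#)         ≡⟨ cong ρ (identityʳ z) ⟩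
    ρ z                ∎

  φ-arc : ∀ {d} → IsArc d → IsArc (φ d)
  φ-arc {x , y} x≢y y≡rot =
    ρ-nonzero (x≢y ∘ x∙y⁻¹≈ε⇒x≈y x y) (identityʳ-unique y _ (sym y≡rot))

  face-cycle⇒minimal-period : ∀ {ℓ d} → FaceIsCycle 𝔾 A ωr ωc ℓ d → MinimalPeriod φ ℓ d
  face-cycle⇒minimal-period {ℓ} {d} (closes , distinct) .returns = closes
  face-cycle⇒minimal-period {ℓ} {d} (closes , distinct) .minimal i i<ℓ returns-early =
    ℕₚ.1+n≢0 (begin
      suc i                  ≡⟨ Finₚ.toℕ-fromℕ< i<ℓ ⟨
      Fin.toℕ (Fin.fromℕ< i<ℓ) ≡⟨ cong Fin.toℕ (distinct _ _ same-vertex) ⟩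
      Fin.toℕ (Fin.fromℕ< 0<ℓ) ≡⟨ Finₚ.toℕ-fromℕ< 0<ℓ ⟩
      0                      ∎)
    where
    0<ℓ : 0 < ℓ
    0<ℓ = ℕₚ.<-trans (s≤s z≤n) i<ℓ
    vertex : ℕ → Fin v
    vertex t = proj₁ (iterate φ t d)
    same-vertex : vertex (Fin.toℕ (Fin.fromℕ< i<ℓ)) ≡ vertex (Fin.toℕ (Fin.fromℕ< 0<ℓ))
    same-vertex rewrite Finₚ.toℕ-fromℕ< i<ℓ | Finₚ.toℕ-fromℕ< 0<ℓ = cong proj₁ returns-early

  module Reversing {σ : Fin v → Fin v} (σ-injective : ∀ {x y} → σ x ≡ σ y → x ≡ y)
    (σ-0 : σ 0# ≡ 0#) (σ-reverses : OrientationReversing 𝔾 A ωr ωc σ) where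

    σ-nonzero : ∀ {x} → x ≢ 0# → σ x ≢ 0#
    σ-nonzero x≢0 σx≡0 = x≢0 (σ-injective (trans σx≡0 (sym σ-0)))

    ρ-reversed : ∀ {x} → x ≢ 0# → ρ (σ (ρ x)) ≡ σ x
    ρ-reversed {x} x≢0 = begin
      ρ (σ (ρ x))                                      ≡⟨ rot-at-0 _ ⟨
      rot 𝔾 A ωr ωc 0# (σ (ρ x))                       ≡⟨ cong₂ (rot 𝔾 A ωr ωc) σ-0 (cong σ (rot-at-0 x)) ⟨
      rot 𝔾 A ωr ωc (σ 0#) (σ (rot 𝔾 A ωr ωc 0# x))   ≡⟨ σ-reverses 0# x (x≢0 ∘ sym) ⟩
      σ x                                              ∎

    module OnPoints = Reversal (_≢ 0#) ρ σ ρ-nonzero σ-nonzero σ-injective ρ-reversed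

    -- σ x = ρᵗ x for some t, and ρᵗ σ ρᵗ = σ then forces σ (ρᵗ x) = x.
    σ-involutive : ∀ x → σ (σ x) ≡ x
    σ-involutive x with x Finₚ.≟ 0#
    ... | yes refl = trans (cong σ σ-0) σ-0
    ... | no x≢0 with t , x→σx ← nonzero-reaches x≢0 (σ-nonzero x≢0) =
      OnPoints.involutive-on-orbit t x≢0 (sym x→σx)

    τ : Fin v × Fin v → Fin v × Fin v
    τ (x , y) = σ y , σ x

    τ-involutive : ∀ d → τ (τ d) ≡ d
    τ-involutive (x , y) = cong₂ _,_ (σ-involutive x) (σ-involutive y)

    τ-arc : ∀ {d} → IsArc d → IsArc (τ d)
    τ-arc x≢y σy≡σx = x≢y (σ-injective (sym σy≡σx))

    τ-injective : ∀ {d e} → τ d ≡ τ e → d ≡ e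
    τ-injective eq = cong₂ _,_ (σ-injective (cong proj₂ eq)) (σ-injective (cong proj₁ eq))

    φ-reversed : ∀ {d} → IsArc d → φ (τ (φ d)) ≡ τ d
    φ-reversed {x , y} x≢y = cong (σ y ,_) (σ-reverses y x (x≢y ∘ sym))

    module OnArcs = Reversal IsArc φ τ φ-arc τ-arc τ-injective φ-reversed

    module FaceLengths {m n a b : ℕ} (m≢n : m ≢ n) (m-odd : m ≡ 2 * a + 1) (n-odd : n ≡ 2 * b + 1)
      (faces : EveryEdgeOnMNFaces 𝔾 A ωr ωc m n) where

      Face : ℕ → Fin v × Fin v → Set
      Face = MinimalPeriod φ

      m-face≢n-face : ∀ {d} → Face m d → Face n d → ⊥
      m-face≢n-face fm fn = m≢n (minimal-period-unique φ fm fn (odd⇒>0 a m-odd) (odd⇒>0 b n-odd))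

      arc-faces : ∀ {x y} → x ≢ y →
        (Face m (x , y) × Face n (y , x)) ⊎ (Face n (x , y) × Face m (y , x))
      arc-faces {x} {y} x≢y with faces x y x≢y
      ... | inj₁ cm , inj₂ cn = inj₁ (face-cycle⇒minimal-period cm , face-cycle⇒minimal-period cn)
      ... | inj₂ cm , inj₁ cn = inj₂ (face-cycle⇒minimal-period cn , face-cycle⇒minimal-period cm)
      ... | inj₁ cm , inj₁ cn =
        ⊥-elim (m-face≢n-face (face-cycle⇒minimal-period cm) (face-cycle⇒minimal-period cn))
      ... | inj₂ cm , inj₂ cn =
        ⊥-elim (m-face≢n-face (face-cycle⇒minimal-period cm) (face-cycle⇒minimal-period cn))

      m-face-reverse : ∀ {x y} → x ≢ y → Face m (x , y) → Face n (y , x)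
      m-face-reverse x≢y fm with arc-faces x≢y
      ... | inj₁ (_ , fn) = fn
      ... | inj₂ (fn , _) = ⊥-elim (m-face≢n-face fm fn)

      n-face-reverse : ∀ {x y} → x ≢ y → Face n (x , y) → Face m (y , x)
      n-face-reverse x≢y fn with arc-faces x≢y
      ... | inj₁ (fm , _) = ⊥-elim (m-face≢n-face fm fn)
      ... | inj₂ (_ , fm) = fm

      σ-fixed-face-reverse : ∀ {ℓ x} → σ x ≡ x → x ≢ 0# → Face ℓ (0# , x) → Face ℓ (x , 0#)
      σ-fixed-face-reverse σx≡x x≢0 face = subst (Face _) (cong₂ _,_ σx≡x σ-0)
        (OnArcs.minimal-period-reversed τ-involutive (x≢0 ∘ sym) face)

      σ-fixes-only-0 : ∀ {x} → σ x ≡ x → x ≡ 0#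
      σ-fixes-only-0 {x} σx≡x with x Finₚ.≟ 0#
      ... | yes x≡0 = x≡0
      ... | no x≢0 with arc-faces {0#} {x} (x≢0 ∘ sym)
      ...   | inj₁ (fm , fn) = ⊥-elim (m-face≢n-face (σ-fixed-face-reverse σx≡x x≢0 fm) fn)
      ...   | inj₂ (fn , fm) = ⊥-elim (m-face≢n-face fm (σ-fixed-face-reverse σx≡x x≢0 fn))

      m-face-at-0 : ∀ {w} → w ≢ 0# → Face m (0# , w) → Face n (0# , ρ w)
      m-face-at-0 {w} w≢0 fm = subst (λ u → Face n (0# , u)) (rot-at-0 w)
        (minimal-period-step φ (m-face-reverse (w≢0 ∘ sym) fm))

      n-face-at-0 : ∀ {w} → w ≢ 0# → Face n (0# , w) → Face m (0# , ρ w)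
      n-face-at-0 {w} w≢0 fn = subst (λ u → Face m (0# , u)) (rot-at-0 w)
        (minimal-period-step φ (n-face-reverse (w≢0 ∘ sym) fn))

      alternation : ∀ {w} → w ≢ 0# → Face m (0# , w) → ∀ k →
        Face m (0# , iterate ρ (k + k) w) × Face n (0# , iterate ρ (suc (k + k)) w)
      alternation w≢0 fm zero = fm , m-face-at-0 w≢0 fm
      alternation {w} w≢0 fm (suc k) = even , m-face-at-0 (ρⁱ-nonzero (suc k + suc k)) even
        where
        ρⁱ-nonzero : ∀ i → iterate ρ i w ≢ 0#
        ρⁱ-nonzero i = iterate-preserves ρ {_≢ 0#} ρ-nonzero i w≢0
        even : Face m (0# , iterate ρ (suc k + suc k) w)
        even = subst (λ t → Face m (0# , iterate ρ (suc t) w)) (sym (ℕₚ.+-suc k k))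
          (n-face-at-0 (ρⁱ-nonzero (suc (k + k))) (proj₂ (alternation w≢0 fm k)))

      even-distance : ∀ {w j} → w ≢ 0# → Face m (0# , w) → Face m (0# , iterate ρ j w) →
                      ∃ λ c → j ≡ c + c
      even-distance {j = j} w≢0 fm fm′ with even⊎odd j
      ... | c , inj₁ refl = c , refl
      ... | k , inj₂ refl = ⊥-elim (m-face≢n-face fm′ (proj₂ (alternation w≢0 fm k)))

      odd-distance : ∀ {w j} → w ≢ 0# → Face m (0# , w) → Face n (0# , iterate ρ j w) →
                     ∃ λ k → j ≡ suc (k + k)
      odd-distance {j = j} w≢0 fm fn with even⊎odd j
      ... | c , inj₁ refl = ⊥-elim (m-face≢n-face (proj₁ (alternation w≢0 fm c)) fn)
      ... | k , inj₂ refl = k , refl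

      -- σ reflects the cycle of ρ on G ∖ {0}; axis points are where the reflection
      -- swaps two consecutive points p and ρ p.
      IsAxis : Fin v → Set
      IsAxis p = p ≢ 0# × σ p ≡ ρ p

      axis-of-symmetric-face : ∀ {ℓ e} c → ℓ ≡ c + suc c → IsArc e → τ e ≡ e → Face ℓ e →
        ∃ λ p → IsAxis p × Face ℓ (0# , ρ p) × iterate φ c (0# , ρ p) ≡ e
      axis-of-symmetric-face {ℓ} {e} c ℓ≡ e-arc τe≡e face = p , (p≢0 , σp≡ρp) , face-at-0 , back
        where
        p z : Fin v
        p = proj₁ (iterate φ c e)
        z = proj₂ (iterate φ c e)
        mid : τ (φ (p , z)) ≡ (p , z)
        mid = OnArcs.odd-orbit-midpoint c e-arc τe≡e (subst (λ t → iterate φ t e ≡ e) ℓ≡ (returns face))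
        z≡0 : z ≡ 0#
        z≡0 = σ-fixes-only-0 (cong proj₂ mid)
        φ-mid : φ (p , z) ≡ (0# , ρ p)
        φ-mid = cong₂ _,_ z≡0 (trans (cong (λ u → rot 𝔾 A ωr ωc u p) z≡0) (rot-at-0 p))
        σρp≡p : σ (ρ p) ≡ p
        σρp≡p = trans (cong (σ ∘ proj₂) (sym φ-mid)) (cong proj₁ mid)
        σp≡ρp : σ p ≡ ρ p
        σp≡ρp = trans (cong σ (sym σρp≡p)) (σ-involutive (ρ p))
        p≢0 : p ≢ 0#
        p≢0 p≡0 = OnArcs.iterate-preserves-P c e-arc (trans p≡0 (sym z≡0))
        face-at-0 : Face ℓ (0# , ρ p)
        face-at-0 = subst (Face ℓ) φ-mid (minimal-period-iterate φ (suc c) face)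
        back : iterate φ c (0# , ρ p) ≡ e
        back = begin
          iterate φ c (0# , ρ p)              ≡⟨ cong (iterate φ c) φ-mid ⟨
          iterate φ c (iterate φ (suc c) e)   ≡⟨ iterate-+ φ c (suc c) e ⟨
          iterate φ (c + suc c) e             ≡⟨ cong (λ t → iterate φ t e) ℓ≡ ⟨
          iterate φ ℓ e                       ≡⟨ returns face ⟩
          e                                   ∎

      IsEndpoint : Fin v → Fin v × Fin v → Set
      IsEndpoint x (y , z) = x ≡ y ⊎ x ≡ z

      axis-through : ∀ {ℓ x} c → ℓ ≡ 2 * c + 1 → x ≢ 0# → Face ℓ (x , σ x) ⊎ Face ℓ (σ x , x) →
        ∃ λ p → IsAxis p × Face ℓ (0# , ρ p) × IsEndpoint x (iterate φ c (0# , ρ p))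
      axis-through {x = x} c ℓ≡ x≢0 (inj₁ face)
        with p , axis , face₀ , back ← axis-of-symmetric-face c (trans ℓ≡ (odd≡half+suc-half c))
               (x≢0 ∘ σ-fixes-only-0 ∘ sym) (cong (_, σ x) (σ-involutive x)) face
        = p , axis , face₀ , inj₁ (cong proj₁ (sym back))
      axis-through {x = x} c ℓ≡ x≢0 (inj₂ face)
        with p , axis , face₀ , back ← axis-of-symmetric-face c (trans ℓ≡ (odd≡half+suc-half c))
               (x≢0 ∘ σ-fixes-only-0) (cong (σ x ,_) (σ-involutive x)) face
        = p , axis , face₀ , inj₂ (cong proj₂ (sym back))

      σ-arc-faces : ∀ {x} → x ≢ 0# →
        (Face m (x , σ x) ⊎ Face m (σ x , x)) × (Face n (x , σ x) ⊎ Face n (σ x , x))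
      σ-arc-faces {x} x≢0 with cm , cn ← faces x (σ x) (x≢0 ∘ σ-fixes-only-0 ∘ sym) =
        Sum.map face-cycle⇒minimal-period face-cycle⇒minimal-period cm ,
        Sum.map face-cycle⇒minimal-period face-cycle⇒minimal-period cn

      m-axis-through : ∀ {x} → x ≢ 0# →
        ∃ λ p → IsAxis p × Face m (0# , ρ p) × IsEndpoint x (iterate φ a (0# , ρ p))
      m-axis-through x≢0 = axis-through a m-odd x≢0 (proj₁ (σ-arc-faces x≢0))

      n-axis-exists : ∀ {x} → x ≢ 0# → ∃ λ r → IsAxis r × Face n (0# , ρ r)
      n-axis-exists x≢0 with r , axis , face , _ ← axis-through b n-odd x≢0 (proj₂ (σ-arc-faces x≢0)) =
        r , axis , face

      face-from-ρ-iterate : ∀ {ℓ p x} t → iterate ρ t p ≡ x → Face ℓ (0# , ρ x) →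
                            Face ℓ (0# , iterate ρ t (ρ p))
      face-from-ρ-iterate {p = p} t p→x =
        subst (λ u → Face _ (0# , u)) (trans (cong ρ (sym p→x)) (iterate-suc ρ t p))

      axis-point-unique : ∀ {p p′ r} → IsAxis p → Face m (0# , ρ p) → IsAxis p′ → Face m (0# , ρ p′) →
                          IsAxis r → Face n (0# , ρ r) → p′ ≡ p
      axis-point-unique {p} (p≢0 , σp≡ρp) fp (p′≢0 , σp′≡ρp′) fp′ (r≢0 , σr≡ρr) fr
        with j , p→r ← nonzero-reaches p≢0 r≢0
        with j′ , p→p′ ← nonzero-reaches p≢0 p′≢0
        with k , refl ← odd-distance {j = j} (ρ-nonzero p≢0) fp (face-from-ρ-iterate j p→r fr)
        with c , refl ← even-distance {j = j′} (ρ-nonzero p≢0) fp (face-from-ρ-iterate j′ p→p′ fp′)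
        = trans (sym p→p′) (iterate-returns-halve ρ k c
            (OnPoints.axis-returns (suc (k + k)) p≢0 σp≡ρp (subst (λ x → σ x ≡ ρ x) (sym p→r) σr≡ρr))
            (OnPoints.axis-returns (c + c) p≢0 σp≡ρp (subst (λ x → σ x ≡ ρ x) (sym p→p′) σp′≡ρp′)))

      on-axis-arc : ∀ {p₀ r} → IsAxis p₀ → Face m (0# , ρ p₀) → IsAxis r → Face n (0# , ρ r) →
                    ∀ {x} → x ≢ 0# → IsEndpoint x (iterate φ a (0# , ρ p₀))
      on-axis-arc axis₀ face₀ axis-r face-r x≢0 with p , axis , face , endpoint ← m-axis-through x≢0 =
        subst (λ q → IsEndpoint _ (iterate φ a (0# , ρ q)))
              (axis-point-unique axis₀ face₀ axis face axis-r face-r) endpoint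

      points-on-0-or-one-arc : ∀ {x₀} → x₀ ≢ 0# → ∃ λ d → ∀ x → x ≡ 0# ⊎ IsEndpoint x d
      points-on-0-or-one-arc x₀≢0
        with p₀ , axis₀ , face₀ , _ ← m-axis-through x₀≢0
        with r , axis-r , face-r ← n-axis-exists x₀≢0
        = iterate φ a (0# , ρ p₀) ,
          λ x → Sum.map₂ (on-axis-arc axis₀ face₀ axis-r face-r) (toSum (x Finₚ.≟ 0#))

proposition3p6 :
    (m n : ℕ) → m ≢ n →
    (∃ λ a → m ≡ 2 * a + 1) → (∃ λ b → n ≡ 2 * b + 1) →
    (v : ℕ) → v ≡ 2 * m * n + 1 → (𝔾 : FinAbGroup v) →
    (m' n' h k : ℕ) (A : Fin m' → Fin n' → Maybe (Fin v)) →
    IsHeffterArray 𝔾 h k A →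
    (ωr ωc : Fin v → Fin v) →
    IsRowOrdering 𝔾 A ωr → IsColumnOrdering 𝔾 A ωc → Compatible 𝔾 A ωr ωc →
    EveryEdgeOnMNFaces 𝔾 A ωr ωc m n →
    ¬ (Σ (Fin v → Fin v) λ σ →
         Bijective _≡_ _≡_ σ × (σ (FinAbGroup.0# 𝔾) ≡ FinAbGroup.0# 𝔾) ×
         OrientationReversing 𝔾 A ωr ωc σ)
proposition3p6 m n m≢n (a , m-odd) (b , n-odd) v v≡ 𝔾 _ _ _ _ A HA ωr ωc RO CO CP faces
               (σ , (σ-injective , _) , σ-0 , σ-reverses) =
  ℕₚ.<⇒≱ 3<v (≤3-if-covered 0# (proj₁ arc) (proj₂ arc) covered)
  where
  open FinAbGroup 𝔾 using (0#)
  open Rotation 𝔾 HA RO CO CP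
  open Reversing σ-injective σ-0 σ-reverses
  open FaceLengths {a = a} {b = b} m≢n m-odd n-odd faces

  3<v : 3 < v
  3<v = subst (3 <_) (sym v≡) (3<2*m*n+1 m≢n (odd⇒>0 a m-odd) (odd⇒>0 b n-odd))

  x₀ : ∃ λ x → x ≢ 0#
  x₀ = another-element (ℕₚ.≤-trans (s≤s (s≤s z≤n)) 3<v) 0#

  arc : Fin v × Fin v
  arc = proj₁ (points-on-0-or-one-arc (proj₂ x₀))

  covered : ∀ x → x ≡ 0# ⊎ IsEndpoint x arc
  covered = proj₂ (points-on-0-or-one-arc (proj₂ x₀))
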